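{- Let $G$ be a cubic graph and let $\tilde G$ be a heavy superposition of $G$. Then $\pi(\tilde G)\ge 5$, i.e. the edges of $\tilde G$ cannot be covered by four perfect matchings.
   Context: $\pi(H)$ denotes the perfect matching index of a cubic graph $H$: the smallest number of perfect matchings whose union is $E(H)$. Graphs may have parallel edges. A multipole is like a graph but may have dangling edges (one end attached to a vertex, the other free); all multipoles are cubic. A $(2,2)$-pole has four dangling edges split into an input connector and an output connector of two edges each. $PG(3,2)$: points are the nonzero vectors of $\mathbb{F}_2^4$, lines the triples $\{x,y,z\}$ with $x+y+z=0$. A tetrahedron $T$ in $PG(3,2)$ is given by four points $p_1,\dots,p_4$ forming a basis of $\mathbb{F}_2^4$ (corner points, of weight $1$); its remaining points are the six sums $c_1+c_2$ of distinct corner points (midpoints, of weight $2$); its lines are the six triples $\{c_1,c_2,c_1+c_2\}$. A $T$-flow (tetrahedral flow) on a cubic graph or multipole is a map $\phi$ from its edges (including dangling ones) to the points of a fixed tetrahedron $T$ such that at each vertex the values on the three incident edges form a line of $T$. A $(2,2)$-pole is heavy if for every tetrahedral flow on it at least two of its four dangling edges receive a value of weight $2$. Heavy superposition: given a cubic graph $G$, replace each vertex $v$ of $G$ by two independent vertices $v_1,v_2$ (lifts, distinct vertices for distinct $v$); replace each edge $e=uv$ of $G$ by a heavy $(2,2)$-pole $X_e$ (pairwise disjoint for distinct edges), attaching the two dangling edges of the input connector of $X_e$ to $u_1$ and $u_2$ respectively and the two dangling edges of the output connector to $v_1$ and $v_2$ respectively. The resulting cubic graph $\tilde G$ is a heavy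 superposition of $G$. -}

module Defs where

open import Data.Nat using (ℕ; _≤_)
open import Data.Fin using (Fin; zero; suc; _≟_)
open import Data.Bool using (Bool; true; false; _xor_)
open import Data.Vec using (Vec; tabulate; zipWith)
open import Data.List using (List; []; _∷_)
open import Data.List.Relation.Binary.Permutation.Propositional using (_↭_)
open import Data.Product using (Σ; ∃; _×_; _,_; proj₁; proj₂)
open import Data.Sum using (_⊎_; inj₁; inj₂)
open import Data.Empty using (⊥)
open import Relation.Nullary using (¬_)
open import Relation.Nullary.Decidable using (⌊_⌋)
open import Relation.Binary.PropositionalEquality using (_≡_; _≢_)
open import Function.Bundles using (_↔_; Inverse)

-- A multipole with dangling-edge set D: vertices V, ordinary edges E
-- (each with two ends, end e 0 and end e 1), and dangling edges D,
-- each with one end attached to a vertex (att d), the other end free.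

record Multipole (D : Set) : Set₁ where
  field
    V   : Set
    E   : Set
    end : E → Fin 2 → V
    att : D → V
    finV : Σ ℕ λ n → V ↔ Fin n
    finE : Σ ℕ λ m → E ↔ Fin m

  Inc : V → Set
  Inc v = (Σ (E × Fin 2) λ p → end (proj₁ p) (proj₂ p) ≡ v)
        ⊎ (Σ D λ d → att d ≡ v)

  field
    cubic    : ∀ v → Fin 3 ↔ Inc v
    loopless : ∀ e → end e zero ≢ end e (suc zero)

  edgeOf : ∀ {v} → Inc v → E ⊎ D
  edgeOf (inj₁ ((e , _) , _)) = inj₁ e
  edgeOf (inj₂ (d , _))       = inj₂ d

open Multipole public

CubicGraph : Set₁
CubicGraph = Multipole ⊥

-- A (2,2)-pole: four dangling edges; 0,1 form the input connector and
-- 2,3 the output connector (in this order).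
Pole22 : Set₁
Pole22 = Multipole (Fin 4)

Pt : Set
Pt = Vec Bool 4

_⊕_ : Pt → Pt → Pt
_⊕_ = zipWith _xor_

corner : Fin 4 → Pt
corner i = tabulate λ j → ⌊ i ≟ j ⌋

IsMidpoint : Pt → Set
IsMidpoint x = Σ (Fin 4) λ i → Σ (Fin 4) λ j → i ≢ j × x ≡ corner i ⊕ corner j

IsLineT : Pt → Pt → Pt → Set
IsLineT x y z = Σ (Fin 4) λ i → Σ (Fin 4) λ j → i ≢ j ×
  ((x ∷ y ∷ z ∷ []) ↭ (corner i ∷ corner j ∷ (corner i ⊕ corner j) ∷ []))

IsTFlow : ∀ {D} (M : Multipole D) → (E M ⊎ D → Pt) → Set
IsTFlow M φ = ∀ v →
  let f = Inverse.to (cubic M v) in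
  IsLineT (φ (edgeOf M (f zero)))
          (φ (edgeOf M (f (suc zero))))
          (φ (edgeOf M (f (suc (suc zero)))))

Heavy : Pole22 → Set
Heavy X = ∀ (φ : E X ⊎ Fin 4 → Pt) → IsTFlow X φ →
  Σ (Fin 4) λ d₁ → Σ (Fin 4) λ d₂ → d₁ ≢ d₂ ×
    IsMidpoint (φ (inj₂ d₁)) × IsMidpoint (φ (inj₂ d₂))

record RawGraph : Set₁ where
  field
    RV   : Set
    RE   : Set
    rend : RE → Fin 2 → RV

open RawGraph public

IsPerfectMatching : (H : RawGraph) → (RE H → Bool) → Set
IsPerfectMatching H M = ∀ v →
  Σ (RE H × Fin 2) λ p → (rend H (proj₁ p) (proj₂ p) ≡ v × M (proj₁ p) ≡ true) ×
    (∀ (q : RE H × Fin 2) → rend H (proj₁ q) (proj₂ q) ≡ v → M (proj₁ q) ≡ true → q ≡ p)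

CoveredBy : RawGraph → ℕ → Set
CoveredBy H k = Σ (Fin k → RE H → Bool) λ Ms →
  (∀ i → IsPerfectMatching H (Ms i)) × (∀ e → Σ (Fin k) λ i → Ms i e ≡ true)

PerfectMatchingIndex≥5 : RawGraph → Set
PerfectMatchingIndex≥5 H = ∀ k → k ≤ 4 → ¬ CoveredBy H k

-- dangling edge d of X_e attaches to lift (snd) of the end (fst) of e:
-- input 0,1 ↦ u₁,u₂ (u = end e 0); output 2,3 ↦ v₁,v₂ (v = end e 1)
conn : Fin 4 → Fin 2 × Fin 2
conn zero                   = zero , zero
conn (suc zero)             = zero , suc zero
conn (suc (suc zero))       = suc zero , zero
conn (suc (suc (suc zero))) = suc zero , suc zero

module _ (G : CubicGraph) (X : E G → Pole22) where

  SupV : Set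
  SupV = (V G × Fin 2) ⊎ (Σ (E G) λ e → V (X e))

  SupE : Set
  SupE = Σ (E G) λ e → E (X e) ⊎ Fin 4

  supEnd : SupE → Fin 2 → SupV
  supEnd (e , inj₁ f) i = inj₂ (e , end (X e) f i)
  supEnd (e , inj₂ d) zero    = inj₁ (end G e (proj₁ (conn d)) , proj₂ (conn d))
  supEnd (e , inj₂ d) (suc _) = inj₂ (e , att (X e) d)

  superposition : RawGraph
  superposition = record { RV = SupV ; RE = SupE ; rend = supEnd }

-- Suppose the edges of the superposition are covered by four perfect matchings, and label each
-- edge by the set of matchings containing it, a nonzero vector of F₂⁴. At every vertex each
-- matching contains exactly one of the three edges, so the three labels partition the four
-- coordinates: two labels have weight 1 and one has weight 2. Keeping weight-1 labels and
-- complementing weight-2 labels gives a tetrahedral flow, so by heaviness every pole X_e has two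
-- dangling edges labelled with weight 2. These end at lifts, and a lift sees only one weight-2
-- label, which yields an injection E(G) × 2 → V(G) × 2, impossible as 2|E(G)| = 3|V(G)|.

module Submission where

open import Defs
open import Data.Nat using (ℕ; zero; suc; _+_; _*_; _≤_; _≤ᵇ_; _⊓_; z≤n; s≤s; s≤s⁻¹)
open import Data.Nat.Properties
  using (+-suc; suc-injective; m+n≡0⇒m≡0; m+n≡0⇒n≡0; *-cancelˡ-≤; m≤n⇒m⊓n≡m; m⊓n≤n)
open import Data.Fin using (Fin; zero; suc; toℕ; fromℕ<; inject≤)
open import Data.Fin.Patterns using (0F; 1F; 2F; 3F)
open import Data.Fin.Properties
  using (_≟_; ¬Fin0; toℕ-injective; toℕ<n; toℕ-fromℕ<; toℕ-inject≤; injective⇒≤; *↔×)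
open import Data.Bool using (Bool; true; false; not; if_then_else_; _xor_)
open import Data.Vec using (Vec; []; _∷_; map; zipWith; tabulate; lookup)
open import Data.Vec.Properties using (lookup∘tabulate; tabulate-cong)
open import Data.List.Relation.Binary.Permutation.Propositional using (refl; swap; prep; trans)
open import Data.Product using (Σ; ∃; _×_; _,_; proj₁; proj₂; uncurry)
open import Data.Product.Function.NonDependent.Propositional using (_×-↔_)
open import Data.Sum using (_⊎_; inj₁; inj₂)
open import Data.Empty using (⊥; ⊥-elim)
open import Function using (_∘_; case_of_)
open import Function.Bundles using (_↔_; Inverse; Injection)
open import Function.Definitions using (Injective)
open import Function.Properties.Inverse using (↔-refl; ↔-sym; ↔-trans; Inverse⇒Injection)
open import Relation.Nullary using (¬_; yes; no)
open import Axiom.UniquenessOfIdentityProofs.WithK using (uip)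
open import Relation.Nullary.Decidable using (⌊_⌋; dec-true; isYes≗does; ⌊⌋-map′)
open import Relation.Binary.PropositionalEquality
  using (_≡_; _≢_; refl; sym; cong; cong₂; subst) renaming (trans to ≡-trans)

weight : ∀ {n} → Vec Bool n → ℕ
weight []           = 0
weight (true  ∷ xs) = suc (weight xs)
weight (false ∷ xs) = weight xs

-- For n = 4 this is corner i, definitionally.
unit : ∀ {n} → Fin n → Vec Bool n
unit i = tabulate λ j → ⌊ i ≟ j ⌋

lookup-unit : ∀ {n} (i : Fin n) → lookup (unit i) i ≡ true
lookup-unit i = ≡-trans (lookup∘tabulate _ i) (≡-trans (isYes≗does (i ≟ i)) (dec-true (i ≟ i) refl))

unit-suc : ∀ {n} (i : Fin n) → unit (suc i) ≡ false ∷ unit i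
unit-suc i = cong (false ∷_) (tabulate-cong λ j → ⌊⌋-map′ _ _ (i ≟ j))

weight-positive : ∀ {n} (x : Vec Bool n) i → lookup x i ≡ true → 1 ≤ weight x
weight-positive (true  ∷ _)  _       _ = s≤s z≤n
weight-positive (false ∷ _)  zero    ()
weight-positive (false ∷ xs) (suc i) t = weight-positive xs i t

weight≡0⇒falses : ∀ {n} (x : Vec Bool n) → weight x ≡ 0 → x ≡ tabulate λ _ → false
weight≡0⇒falses []           _ = refl
weight≡0⇒falses (false ∷ xs) w = cong (false ∷_) (weight≡0⇒falses xs w)

weight≡1⇒unit : ∀ {n} (x : Vec Bool n) → weight x ≡ 1 → ∃ λ i → x ≡ unit i
weight≡1⇒unit (true  ∷ xs) w = zero , cong (true ∷_) (weight≡0⇒falses xs (suc-injective w))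
weight≡1⇒unit (false ∷ xs) w with weight≡1⇒unit xs w
... | i , refl = suc i , sym (unit-suc i)

data ExactlyOne : Bool → Bool → Bool → Set where
  first  : ExactlyOne true false false
  second : ExactlyOne false true false
  third  : ExactlyOne false false true

infixr 5 _∷_
data Partition : ∀ {n} → Vec Bool n → Vec Bool n → Vec Bool n → Set where
  []  : Partition [] [] []
  _∷_ : ∀ {n a b c} {as bs cs : Vec Bool n} →
        ExactlyOne a b c → Partition as bs cs → Partition (a ∷ as) (b ∷ bs) (c ∷ cs)

unique-true⇒ExactlyOne : (b : Fin 3 → Bool) → ∃ (λ j → b j ≡ true) →
  (∀ j k → b j ≡ true → b k ≡ true → j ≡ k) → ExactlyOne (b 0F) (b 1F) (b 2F)
unique-true⇒ExactlyOne b (j , bj) unique with b 0F in e₀ | b 1F in e₁ | b 2F in e₂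
... | true  | false | false = first
... | false | true  | false = second
... | false | false | true  = third
... | true  | true  | _     = case unique 0F 1F e₀ e₁ of λ ()
... | true  | false | true  = case unique 0F 2F e₀ e₂ of λ ()
... | false | true  | true  = case unique 1F 2F e₁ e₂ of λ ()
... | false | false | false with j
...   | 0F = case ≡-trans (sym bj) e₀ of λ ()
...   | 1F = case ≡-trans (sym bj) e₁ of λ ()
...   | 2F = case ≡-trans (sym bj) e₂ of λ ()

partition-tabulate : ∀ {n} {f g h : Fin n → Bool} → (∀ i → ExactlyOne (f i) (g i) (h i)) →
  Partition (tabulate f) (tabulate g) (tabulate h)
partition-tabulate {zero}  _ = []
partition-tabulate {suc n} p = p 0F ∷ partition-tabulate (p ∘ suc)

partition-rotate : ∀ {n} {a b c : Vec Bool n} → Partition a b c → Partition b c a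
partition-rotate []           = []
partition-rotate (first  ∷ p) = third  ∷ partition-rotate p
partition-rotate (second ∷ p) = first  ∷ partition-rotate p
partition-rotate (third  ∷ p) = second ∷ partition-rotate p

partition-disjoint : ∀ {n} {a b c : Vec Bool n} → Partition a b c →
  ∀ i → lookup a i ≡ true → lookup b i ≡ true → ⊥
partition-disjoint (first  ∷ p) 0F      _  ()
partition-disjoint (second ∷ p) 0F      () _
partition-disjoint (third  ∷ p) 0F      () _
partition-disjoint (_      ∷ p) (suc i) ta tb = partition-disjoint p i ta tb

exactlyOne-not : ∀ {a b c} → ExactlyOne a b c → not c ≡ a xor b
exactlyOne-not first  = refl
exactlyOne-not second = refl
exactlyOne-not third  = refl

partition-complement : ∀ {n} {a b c : Vec Bool n} → Partition a b c → map not c ≡ zipWith _xor_ a b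
partition-complement []      = refl
partition-complement (o ∷ p) = cong₂ _∷_ (exactlyOne-not o) (partition-complement p)

partition-weight : ∀ {n} {a b c : Vec Bool n} → Partition a b c → weight a + weight b + weight c ≡ n
partition-weight []           = refl
partition-weight (first  ∷ p) = cong suc (partition-weight p)
partition-weight {a = _ ∷ as} {_ ∷ bs} {_ ∷ cs} (second ∷ p) =
  ≡-trans (cong (_+ weight cs) (+-suc (weight as) (weight bs))) (cong suc (partition-weight p))
partition-weight {a = _ ∷ as} {_ ∷ bs} {_ ∷ cs} (third  ∷ p) =
  ≡-trans (+-suc (weight as + weight bs) (weight cs)) (cong suc (partition-weight p))

TwoOneOne : (Fin 3 → ℕ) → Set
TwoOneOne w = Σ (Fin 3) λ h → w h ≡ 2 × (∀ j → j ≢ h → w j ≡ 1)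

sum≡1 : ∀ p q r → p + q + r ≡ 1 →
  (p ≡ 1 × q ≡ 0 × r ≡ 0) ⊎ (p ≡ 0 × q ≡ 1 × r ≡ 0) ⊎ (p ≡ 0 × q ≡ 0 × r ≡ 1)
sum≡1 zero    zero    r s = inj₂ (inj₂ (refl , refl , s))
sum≡1 zero    (suc q) r s =
  inj₂ (inj₁ (refl , cong suc (m+n≡0⇒m≡0 q q+r≡0) , m+n≡0⇒n≡0 q q+r≡0))
  where q+r≡0 = suc-injective s
sum≡1 (suc p) q       r s =
  inj₁ (cong suc (m+n≡0⇒m≡0 p p+q≡0) , m+n≡0⇒n≡0 p p+q≡0 , m+n≡0⇒n≡0 (p + q) p+q+r≡0)
  where
    p+q+r≡0 = suc-injective s
    p+q≡0   = m+n≡0⇒m≡0 (p + q) p+q+r≡0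

suc+suc+suc : ∀ p q r → suc p + suc q + suc r ≡ 3 + (p + q + r)
suc+suc+suc p q r =
  cong suc (≡-trans (+-suc (p + suc q) r) (cong (λ t → suc (t + r)) (+-suc p q)))

positive-sum≡4 : (w : Fin 3 → ℕ) → (∀ j → 1 ≤ w j) → w 0F + w 1F + w 2F ≡ 4 → TwoOneOne w
positive-sum≡4 w pos s with w 0F in e₀ | w 1F in e₁ | w 2F in e₂ | pos 0F | pos 1F | pos 2F
... | suc p | suc q | suc r | s≤s _ | s≤s _ | s≤s _
  with sum≡1 p q r (suc-injective (suc-injective (suc-injective
         (≡-trans (sym (suc+suc+suc p q r)) s))))
... | inj₁ (refl , refl , refl) =
  0F , e₀ , λ { 0F ne → ⊥-elim (ne refl) ; 1F _ → e₁ ; 2F _ → e₂ }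
... | inj₂ (inj₁ (refl , refl , refl)) =
  1F , e₁ , λ { 0F _ → e₀ ; 1F ne → ⊥-elim (ne refl) ; 2F _ → e₂ }
... | inj₂ (inj₂ (refl , refl , refl)) =
  2F , e₂ , λ { 0F _ → e₀ ; 1F _ → e₁ ; 2F ne → ⊥-elim (ne refl) }

long : Pt → Bool
long x = 2 ≤ᵇ weight x

-- At a vertex, the complement of the weight-2 label is the sum of the two corners named by
-- the other two labels.
toT : Pt → Pt
toT x = if long x then map not x else x

long-light : ∀ x → weight x ≡ 1 → long x ≡ false
long-light _ w = cong (2 ≤ᵇ_) w

long-heavy : ∀ x → weight x ≡ 2 → long x ≡ true
long-heavy _ w = cong (2 ≤ᵇ_) w

toT-short : ∀ {x} → long x ≡ false → toT x ≡ x
toT-short {x} l = cong (λ b → if b then map not x else x) l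

toT-long : ∀ {x} → long x ≡ true → toT x ≡ map not x
toT-long {x} l = cong (λ b → if b then map not x else x) l

weight-corner⊕corner : ∀ i j → i ≢ j → weight (corner i ⊕ corner j) ≡ 2
weight-corner⊕corner 0F 0F ne = ⊥-elim (ne refl)
weight-corner⊕corner 0F 1F _  = refl
weight-corner⊕corner 0F 2F _  = refl
weight-corner⊕corner 0F 3F _  = refl
weight-corner⊕corner 1F 0F _  = refl
weight-corner⊕corner 1F 1F ne = ⊥-elim (ne refl)
weight-corner⊕corner 1F 2F _  = refl
weight-corner⊕corner 1F 3F _  = refl
weight-corner⊕corner 2F 0F _  = refl
weight-corner⊕corner 2F 1F _  = refl
weight-corner⊕corner 2F 2F ne = ⊥-elim (ne refl)
weight-corner⊕corner 2F 3F _  = refl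
weight-corner⊕corner 3F 0F _  = refl
weight-corner⊕corner 3F 1F _  = refl
weight-corner⊕corner 3F 2F _  = refl
weight-corner⊕corner 3F 3F ne = ⊥-elim (ne refl)

midpoint-weight : ∀ {x} → IsMidpoint x → weight x ≡ 2
midpoint-weight (i , j , i≢j , refl) = weight-corner⊕corner i j i≢j

midpoint-toT⇒long : ∀ x → IsMidpoint (toT x) → long x ≡ true
midpoint-toT⇒long x m with long x in l
... | true  = refl
... | false = ≡-trans (sym l) (long-heavy x (midpoint-weight m))

IsLineT-cong : ∀ {x x′ y y′ z z′} → x ≡ x′ → y ≡ y′ → z ≡ z′ → IsLineT x′ y′ z′ → IsLineT x y z
IsLineT-cong refl refl refl l = l

IsLineT-rotate : ∀ {x y z} → IsLineT y z x → IsLineT x y z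
IsLineT-rotate (i , j , i≢j , p) =
  i , j , i≢j , trans (trans (swap _ _ refl) (prep _ (swap _ _ refl))) p

light-light-heavy-line : ∀ {a b c} → Partition a b c → weight a ≡ 1 → weight b ≡ 1 → weight c ≡ 2 →
  IsLineT (toT a) (toT b) (toT c)
light-light-heavy-line {a} {b} {c} p wa wb wc with weight≡1⇒unit a wa | weight≡1⇒unit b wb
... | i , refl | j , refl =
  IsLineT-cong (toT-short (long-light a wa)) (toT-short (long-light b wb))
    (≡-trans (toT-long (long-heavy c wc)) (partition-complement p))
    (i , j , i≢j , refl)
  where
    i≢j : i ≢ j
    i≢j refl = partition-disjoint p i (lookup-unit i) (lookup-unit i)

partition-line : (x : Fin 3 → Pt) → Partition (x 0F) (x 1F) (x 2F) → TwoOneOne (weight ∘ x) →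
  IsLineT (toT (x 0F)) (toT (x 1F)) (toT (x 2F))
partition-line x p (0F , w , light) =
  IsLineT-rotate (light-light-heavy-line (partition-rotate p) (light 1F λ ()) (light 2F λ ()) w)
partition-line x p (1F , w , light) =
  IsLineT-rotate (IsLineT-rotate
    (light-light-heavy-line (partition-rotate (partition-rotate p)) (light 2F λ ()) (light 0F λ ()) w))
partition-line x p (2F , w , light) = light-light-heavy-line p (light 0F λ ()) (light 1F λ ()) w

long-unique : (x : Fin 3 → Pt) → TwoOneOne (weight ∘ x) →
  ∀ j k → long (x j) ≡ true → long (x k) ≡ true → j ≡ k
long-unique x (h , _ , light) j k lj lk = ≡-trans (long⇒≡h j lj) (sym (long⇒≡h k lk))
  where
    long⇒≡h : ∀ j → long (x j) ≡ true → j ≡ h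
    long⇒≡h j l with j ≟ h
    ... | yes j≡h = j≡h
    ... | no  j≢h = case ≡-trans (sym l) (long-light (x j) (light j j≢h)) of λ ()

EndsAt : (H : RawGraph) → RE H × Fin 2 → RV H → Set
EndsAt H p v = rend H (proj₁ p) (proj₂ p) ≡ v

record Star (H : RawGraph) (v : RV H) : Set where
  field
    spoke           : Fin 3 → RE H × Fin 2
    spoke-at        : ∀ j → EndsAt H (spoke j) v
    spoke-injective : Injective _≡_ _≡_ spoke
    spoke-onto      : ∀ p → EndsAt H p v → ∃ λ j → p ≡ spoke j

star-via : ∀ {H v} {I : Set} → Fin 3 ↔ I → (h : I → RE H × Fin 2) → (∀ t → EndsAt H (h t) v) →
  Injective _≡_ _≡_ h → (∀ p → EndsAt H p v → ∃ λ t → p ≡ h t) → Star H v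
star-via iso h at h-injective onto = record
  { spoke           = h ∘ to
  ; spoke-at        = at ∘ to
  ; spoke-injective = λ e → Injection.injective (Inverse⇒Injection iso) (h-injective e)
  ; spoke-onto      = λ p e → from (proj₁ (onto p e)) ,
                              ≡-trans (proj₂ (onto p e)) (cong h (sym (strictlyInverseˡ _)))
  }
  where open Inverse iso

perfectMatching-exactlyOne : ∀ {H v} (S : Star H v) {M} → IsPerfectMatching H M →
  let open Star S in ExactlyOne (M (proj₁ (spoke 0F))) (M (proj₁ (spoke 1F))) (M (proj₁ (spoke 2F)))
perfectMatching-exactlyOne {v = v} S {M} pm with pm v
... | p , (p-at , Mp) , unique = unique-true⇒ExactlyOne (M ∘ proj₁ ∘ spoke) matched at-most-one
  where
    open Star S
    matched : ∃ λ j → M (proj₁ (spoke j)) ≡ true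
    matched with spoke-onto p p-at
    ... | j , refl = j , Mp
    at-most-one : ∀ j k → M (proj₁ (spoke j)) ≡ true → M (proj₁ (spoke k)) ≡ true → j ≡ k
    at-most-one j k mj mk =
      spoke-injective (≡-trans (unique _ (spoke-at j) mj) (sym (unique _ (spoke-at k) mk)))

module FourCover (H : RawGraph) (N : Fin 4 → RE H → Bool) (pm : ∀ i → IsPerfectMatching H (N i))
                 (cover : ∀ q → ∃ λ i → N i q ≡ true) where

  indicator : RE H → Pt
  indicator q = tabulate λ i → N i q

  indicator-positive : ∀ q → 1 ≤ weight (indicator q)
  indicator-positive q with cover q
  ... | i , t = weight-positive (indicator q) i (≡-trans (lookup∘tabulate (λ i → N i q) i) t)

  module _ {v} (S : Star H v) where
    open Star S

    labels : Fin 3 → Pt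
    labels j = indicator (proj₁ (spoke j))

    star-partition : Partition (labels 0F) (labels 1F) (labels 2F)
    star-partition = partition-tabulate λ i → perfectMatching-exactlyOne S (pm i)

    star-twoOneOne : TwoOneOne (weight ∘ labels)
    star-twoOneOne = positive-sum≡4 _ (λ j → indicator-positive _) (partition-weight star-partition)

    star-line : IsLineT (toT (labels 0F)) (toT (labels 1F)) (toT (labels 2F))
    star-line = partition-line labels star-partition star-twoOneOne

    star-long-unique : ∀ p q → EndsAt H p v → EndsAt H q v →
      long (indicator (proj₁ p)) ≡ true → long (indicator (proj₁ q)) ≡ true → p ≡ q
    star-long-unique p q p-at q-at lp lq with spoke-onto p p-at | spoke-onto q q-at
    ... | j , refl | k , refl = cong spoke (long-unique labels star-twoOneOne j k lp lq)

conn⁻¹ : Fin 2 × Fin 2 → Fin 4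
conn⁻¹ (0F , 0F) = 0F
conn⁻¹ (0F , 1F) = 1F
conn⁻¹ (1F , 0F) = 2F
conn⁻¹ (1F , 1F) = 3F

conn∘conn⁻¹ : ∀ p → conn (conn⁻¹ p) ≡ p
conn∘conn⁻¹ (0F , 0F) = refl
conn∘conn⁻¹ (0F , 1F) = refl
conn∘conn⁻¹ (1F , 0F) = refl
conn∘conn⁻¹ (1F , 1F) = refl

conn⁻¹∘conn : ∀ d → conn⁻¹ (conn d) ≡ d
conn⁻¹∘conn 0F = refl
conn⁻¹∘conn 1F = refl
conn⁻¹∘conn 2F = refl
conn⁻¹∘conn 3F = refl

conn⁻¹-injective : Injective _≡_ _≡_ conn⁻¹
conn⁻¹-injective {p} {q} e = ≡-trans (sym (conn∘conn⁻¹ p)) (≡-trans (cong conn e) (conn∘conn⁻¹ q))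

module Superposition (G : CubicGraph) (X : E G → Pole22) where

  H : RawGraph
  H = superposition G X

  dangling-injective : ∀ {e e′ d d′ s s′} →
    _≡_ {A = SupE G X × Fin 2} ((e , inj₂ d) , s) ((e′ , inj₂ d′) , s′) → e ≡ e′ × d ≡ d′
  dangling-injective refl = refl , refl

  -- End 1 of a dangling edge of X e is the one inside X e.
  side : ∀ {e w} → Inc (X e) w → Fin 2
  side (inj₁ ((_ , i) , _)) = i
  side (inj₂ _)             = 1F

  inner-end : ∀ e {w} → Inc (X e) w → SupE G X × Fin 2
  inner-end e t = (e , edgeOf (X e) t) , side t

  inner-end-at : ∀ e {w} (t : Inc (X e) w) → EndsAt H (inner-end e t) (inj₂ (e , w))
  inner-end-at e (inj₁ (_ , refl)) = refl
  inner-end-at e (inj₂ (_ , refl)) = refl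

  inner-end-injective : ∀ e {w} → Injective _≡_ _≡_ (inner-end e {w})
  inner-end-injective e {_} {inj₁ ((f , i) , p)} {inj₁ (_ , p′)} refl =
    cong (λ p → inj₁ ((f , i) , p)) (uip p p′)
  inner-end-injective e {_} {inj₂ (d , p)}       {inj₂ (_ , p′)} refl =
    cong (λ p → inj₂ (d , p)) (uip p p′)
  inner-end-injective e {_} {inj₁ _}             {inj₂ _}        ()
  inner-end-injective e {_} {inj₂ _}             {inj₁ _}        ()

  inner-end-onto : ∀ e w p → EndsAt H p (inj₂ (e , w)) → ∃ λ (t : Inc (X e) w) → p ≡ inner-end e t
  inner-end-onto e .(end (X e) f i) ((.e , inj₁ f) , i)  refl = inj₁ ((f , i) , refl) , refl
  inner-end-onto e .(att (X e) d)   ((.e , inj₂ d) , 1F) refl = inj₂ (d , refl) , refl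
  inner-end-onto e w                ((_  , inj₂ d) , 0F) ()

  inner-star : ∀ e w → Star H (inj₂ (e , w))
  inner-star e w =
    star-via (cubic (X e) w) (inner-end e) (inner-end-at e) (inner-end-injective e) (inner-end-onto e w)

  lift-end : ∀ {v} → Fin 2 → Inc G v → SupE G X × Fin 2
  lift-end s (inj₁ ((e , i) , _)) = (e , inj₂ (conn⁻¹ (i , s))) , 0F
  lift-end s (inj₂ (() , _))

  lift-end-at : ∀ {v} s (t : Inc G v) → EndsAt H (lift-end s t) (inj₁ (v , s))
  lift-end-at s (inj₁ ((e , i) , refl)) =
    cong (λ (i , s) → inj₁ (end G e i , s)) (conn∘conn⁻¹ (i , s))
  lift-end-at s (inj₂ (() , _))

  lift-end-injective : ∀ {v} s → Injective _≡_ _≡_ (lift-end {v} s)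
  lift-end-injective s {inj₁ ((e , i) , p)} {inj₁ (_ , p′)} eq with dangling-injective eq
  ... | refl , d≡d′ with conn⁻¹-injective d≡d′
  ... | refl = cong (λ p → inj₁ ((e , i) , p)) (uip p p′)
  lift-end-injective s {inj₂ (() , _)}
  lift-end-injective s {inj₁ _} {inj₂ (() , _)}

  lift-end-onto : ∀ v s p → EndsAt H p (inj₁ (v , s)) → ∃ λ (t : Inc G v) → p ≡ lift-end s t
  lift-end-onto .(end G e (proj₁ (conn d))) .(proj₂ (conn d)) ((e , inj₂ d) , 0F) refl =
    inj₁ ((e , proj₁ (conn d)) , refl) , cong (λ d → (e , inj₂ d) , 0F) (sym (conn⁻¹∘conn d))
  lift-end-onto v s ((_ , inj₁ _) , _)  ()
  lift-end-onto v s ((_ , inj₂ _) , 1F) ()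

  lift-star : ∀ v s → Star H (inj₁ (v , s))
  lift-star v s =
    star-via (cubic G v) (lift-end s) (lift-end-at s) (lift-end-injective s) (lift-end-onto v s)

  module _ (heavy : ∀ e → Heavy (X e)) (N : Fin 4 → SupE G X → Bool)
           (pm : ∀ i → IsPerfectMatching H (N i)) (cover : ∀ q → ∃ λ i → N i q ≡ true) where

    open FourCover H N pm cover

    pole-flow : ∀ e → E (X e) ⊎ Fin 4 → Pt
    pole-flow e y = toT (indicator (e , y))

    pole-flow-isTFlow : ∀ e → IsTFlow (X e) (pole-flow e)
    pole-flow-isTFlow e w = star-line (inner-star e w)

    -- Opaque so that later with-abstractions do not normalise the T-flow proof inside it.
    opaque
      long-ports : ∀ e → Σ (Fin 2 → Fin 4) λ port →
        Injective _≡_ _≡_ port × (∀ k → long (indicator (e , inj₂ (port k))) ≡ true)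
      long-ports e with heavy e (pole-flow e) (pole-flow-isTFlow e)
      ... | d₀ , d₁ , d₀≢d₁ , m₀ , m₁ = port , port-injective , port-long
        where
          port : Fin 2 → Fin 4
          port 0F = d₀
          port 1F = d₁
          port-injective : Injective _≡_ _≡_ port
          port-injective {0F} {0F} _ = refl
          port-injective {0F} {1F} e = ⊥-elim (d₀≢d₁ e)
          port-injective {1F} {0F} e = ⊥-elim (d₀≢d₁ (sym e))
          port-injective {1F} {1F} _ = refl
          port-long : ∀ k → long (indicator (e , inj₂ (port k))) ≡ true
          port-long 0F = midpoint-toT⇒long (indicator (e , inj₂ d₀)) m₀
          port-long 1F = midpoint-toT⇒long (indicator (e , inj₂ d₁)) m₁

    port : E G → Fin 2 → Fin 4
    port e = proj₁ (long-ports e)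

    port-end : E G × Fin 2 → SupE G X × Fin 2
    port-end (e , k) = (e , inj₂ (port e k)) , 0F

    attach : E G × Fin 2 → V G × Fin 2
    attach (e , k) = end G e (proj₁ (conn (port e k))) , proj₂ (conn (port e k))

    port-end-at : ∀ ek → EndsAt H (port-end ek) (inj₁ (attach ek))
    port-end-at _ = refl

    port-end-long : ∀ ek → long (indicator (proj₁ (port-end ek))) ≡ true
    port-end-long (e , k) = proj₂ (proj₂ (long-ports e)) k

    port-end-injective : Injective _≡_ _≡_ port-end
    port-end-injective {e , k} {e′ , k′} eq with dangling-injective eq
    ... | refl , port≡ = cong (e ,_) (proj₁ (proj₂ (long-ports e)) port≡)

    attach-injective : Injective _≡_ _≡_ attach
    attach-injective {ek} {ek′} eq = port-end-injective
      (star-long-unique (uncurry lift-star (attach ek′)) (port-end ek) (port-end ek′)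
        (≡-trans (port-end-at ek) (cong inj₁ eq)) (port-end-at ek′)
        (port-end-long ek) (port-end-long ek′))

incidence-end : ∀ {G : CubicGraph} {v} → Inc G v → E G × Fin 2
incidence-end (inj₁ (ei , _)) = ei
incidence-end (inj₂ (() , _))

incidence-end-injective : ∀ {G : CubicGraph} {v v′} (t : Inc G v) (t′ : Inc G v′) →
  incidence-end {G} t ≡ incidence-end {G} t′ → _≡_ {A = Σ (V G) (Inc G)} (v , t) (v′ , t′)
incidence-end-injective (inj₁ (_ , refl)) (inj₁ (_ , refl)) refl = refl
incidence-end-injective (inj₂ (() , _))   _                   _
incidence-end-injective (inj₁ _)          (inj₂ (() , _))     _

incidence : (G : CubicGraph) → V G × Fin 3 → E G × Fin 2
incidence G (v , j) = incidence-end {G} (Inverse.to (cubic G v) j)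

incidence-injective : (G : CubicGraph) → Injective _≡_ _≡_ (incidence G)
incidence-injective G {v , j} {v′ , j′} eq =
  ≡-trans (sym (recover-to v j))
    (≡-trans (cong recover (incidence-end-injective {G} _ _ eq)) (recover-to v′ j′))
  where
    recover : Σ (V G) (Inc G) → V G × Fin 3
    recover (v , t) = v , Inverse.from (cubic G v) t
    recover-to : ∀ v j → recover (v , Inverse.to (cubic G v) j) ≡ (v , j)
    recover-to v j = cong (v ,_) (Inverse.strictlyInverseʳ (cubic G v) j)

injection-size-≤ : ∀ {A B : Set} {m n} → A ↔ Fin m → B ↔ Fin n →
  (f : A → B) → Injective _≡_ _≡_ f → m ≤ n
injection-size-≤ A↔ B↔ f f-injective =
  injective⇒≤ λ e → Injection.injective (Inverse⇒Injection (↔-sym A↔))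
                      (f-injective (Injection.injective (Inverse⇒Injection B↔) e))

×-Fin-↔ : ∀ {A : Set} {n k} → A ↔ Fin n → (A × Fin k) ↔ Fin (n * k)
×-Fin-↔ A↔ = ↔-trans (A↔ ×-↔ ↔-refl) (↔-sym *↔×)

n*3≤n*2⇒n≡0 : ∀ n → n * 3 ≤ n * 2 → n ≡ 0
n*3≤n*2⇒n≡0 zero    _ = refl
n*3≤n*2⇒n≡0 (suc n) h with *-cancelˡ-≤ (suc n) h
... | s≤s (s≤s ())

cubic-2E↪2V⇒empty : (G : CubicGraph) (f : E G × Fin 2 → V G × Fin 2) → Injective _≡_ _≡_ f →
  ¬ V G
cubic-2E↪2V⇒empty G f f-injective v with finV G
... | n , V↔ with n*3≤n*2⇒n≡0 n (injection-size-≤ (×-Fin-↔ V↔) (×-Fin-↔ V↔) (f ∘ incidence G)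
                                  (λ e → incidence-injective G (f-injective e)))
... | refl = ¬Fin0 (Inverse.to V↔ v)

no-four-cover : (G : CubicGraph) → V G → (X : E G → Pole22) → (∀ e → Heavy (X e)) →
  ¬ CoveredBy (superposition G X) 4
no-four-cover G v X heavy (N , pm , cover) =
  cubic-2E↪2V⇒empty G (attach heavy N pm cover) (attach-injective heavy N pm cover) v
  where open Superposition G X

CoveredBy-pad : ∀ {H k m} → k ≤ m → CoveredBy H (suc k) → CoveredBy H (suc m)
CoveredBy-pad {k = k} k≤m (M , pm , cover) = M ∘ clamp , pm ∘ clamp , cover′
  where
    clamp : ∀ {m} → Fin (suc m) → Fin (suc k)
    clamp i = fromℕ< (s≤s (m⊓n≤n (toℕ i) k))
    clamp-inject≤ : ∀ j → clamp (inject≤ j (s≤s k≤m)) ≡ j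
    clamp-inject≤ j = toℕ-injective (≡-trans (toℕ-fromℕ< _)
      (≡-trans (cong (_⊓ k) (toℕ-inject≤ j _)) (m≤n⇒m⊓n≡m (s≤s⁻¹ (toℕ<n j)))))
    cover′ : ∀ q → ∃ λ i → M (clamp i) q ≡ true
    cover′ q with cover q
    ... | j , t = inject≤ j (s≤s k≤m) , subst (λ i → M i q ≡ true) (sym (clamp-inject≤ j)) t

theorem4p4 : (G : CubicGraph) → V G → (X : E G → Pole22) → (∀ e → Heavy (X e)) →
    PerfectMatchingIndex≥5 (superposition G X)
theorem4p4 G v X heavy zero    _   (_ , _ , cover) =
  ¬Fin0 (proj₁ (cover (proj₁ (incidence G (v , 0F)) , inj₂ 0F)))
theorem4p4 G v X heavy (suc k) k<5 cover =
  no-four-cover G v X heavy (CoveredBy-pad (s≤s⁻¹ k<5) cover)
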